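{- Let $1\le k<n$, let $T=(t_{ab})\in\mathcal{T}_{k,n}$, and let $\varphi_{NC}(T)$ be the unique multiset of pairwise noncrossing vectors of $V^*_{k,n}$ whose summing tableau is $T$. Then: (i) $T$ is strictly increasing along rows (i.e. $t_{a,b}<t_{a,b+1}$ for all $a\in[k]$, $b\in[n-k-1]$) if and only if every vector $(b+1,b+2,\dots,b+k)$ with $b\in[n-k-1]$ appears in $\varphi_{NC}(T)$; (ii) $T$ is strictly increasing along columns (i.e. $t_{a+1,b}<t_{a,b}$ for all $a\in[k-1]$, $b\in[n-k]$) if and only if every vector $(1,\dots,a,n-k+a+1,\dots,n)$ with $a\in[k-1]$ appears in $\varphi_{NC}(T)$.
   Context: $V_{k,n}$ is the set of strictly increasing vectors $(i_1,\dots,i_k)$ with entries in $[n]$; $V^*_{k,n}=V_{k,n}\setminus\{(n-k+1,\dots,n)\}$. $\mathcal{T}_{k,n}$ is the set of matrices $T=(t_{ab})\in\mathbb{N}^{k\times(n-k)}$ (row 1 on top) with $t_{a,b}\le t_{a,b+1}$ and $t_{a+1,b}\le t_{a,b}$. The summing tableau of a multiset $L$ of vectors of $V_{k,n}$ has entries $t_{ab}=\#\{I\in L: i_a\le a+b-1\}$ (with multiplicity). Arcs $(p<p')$, $(q<q')$ cross if $p<q<p'<q'$ or $q<p<q'<p'$; $I,J$ are noncrossing if for all $1\le a<b\le k$ with $i_\ell=j_\ell$ for all $a<\ell<b$, the arcs $(i_a<i_b)$ and $(j_a<j_b)$ do not cross. Every $T\in\mathcal{T}_{k,n}$ is the summing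 tableau of exactly one multiset of pairwise noncrossing vectors of $V^*_{k,n}$, denoted $\varphi_{NC}(T)$. -}

module Defs where

open import Data.Nat using (ℕ; zero; suc; _+_; _∸_; _≤_; _<_; _≤?_; _<?_)
open import Data.Fin using (Fin; toℕ)
import Data.Fin as F
open import Data.Vec using (Vec; lookup; tabulate)
open import Data.List using (List; length; filter)
open import Data.Product using (_×_)
open import Data.Sum using (_⊎_)
open import Relation.Nullary using (¬_; yes; no)
open import Relation.Binary.PropositionalEquality using (_≡_; _≢_)

-- A vector (i_1,...,i_k) is a `Vec ℕ k`; entry i_a (1-based a) is
-- `lookup v a'` with a' : Fin k, toℕ a' = a - 1.
Vector : ℕ → Set
Vector k = Vec ℕ k

InV : (k n : ℕ) → Vector k → Set
InV k n v =
  (∀ (a : Fin k) → 1 ≤ lookup v a × lookup v a ≤ n) ×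
  (∀ (a b : Fin k) → a F.< b → lookup v a < lookup v b)

topVec : (k n : ℕ) → Vector k
topVec k n = tabulate (λ a → suc (n ∸ k + toℕ a))

InVstar : (k n : ℕ) → Vector k → Set
InVstar k n v = InV k n v × v ≢ topVec k n

-- k × (n-k) tableaux with natural entries; T a b is t_{a+1,b+1} (0-based Fin indices)
Tableau : ℕ → ℕ → Set
Tableau k n = Fin k → Fin (n ∸ k) → ℕ

InTkn : (k n : ℕ) → Tableau k n → Set
InTkn k n T =
  (∀ (a : Fin k) (b b' : Fin (n ∸ k)) → toℕ b' ≡ suc (toℕ b) → T a b ≤ T a b') ×
  (∀ (a a' : Fin k) (b : Fin (n ∸ k)) → toℕ a' ≡ suc (toℕ a) → T a' b ≤ T a b)

RowStrict : (k n : ℕ) → Tableau k n → Set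
RowStrict k n T =
  ∀ (a : Fin k) (b b' : Fin (n ∸ k)) → toℕ b' ≡ suc (toℕ b) → T a b < T a b'

ColStrict : (k n : ℕ) → Tableau k n → Set
ColStrict k n T =
  ∀ (a a' : Fin k) (b : Fin (n ∸ k)) → toℕ a' ≡ suc (toℕ a) → T a' b < T a b

-- summing tableau: t_{ab} = #{ I ∈ L : i_a ≤ a + b - 1 } (1-based a, b),
-- i.e. with 0-based a', b': i_{a'+1} ≤ a' + b' + 1; counted with multiplicity
summingTableau : (k n : ℕ) → List (Vector k) → Tableau k n
summingTableau k n L a b = length (filter (λ v → lookup v a ≤? suc (toℕ a + toℕ b)) L)

Cross : ℕ → ℕ → ℕ → ℕ → Set
Cross p p' q q' = (p < q × q < p' × p' < q') ⊎ (q < p × p < q' × q' < p')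

Noncrossing : (k : ℕ) → Vector k → Vector k → Set
Noncrossing k I J =
  ∀ (a b : Fin k) → a F.< b →
    (∀ (l : Fin k) → a F.< l → l F.< b → lookup I l ≡ lookup J l) →
    ¬ Cross (lookup I a) (lookup I b) (lookup J a) (lookup J b)

shiftVec : (k b : ℕ) → Vector k
shiftVec k b = tabulate (λ i → suc (b + toℕ i))

splitVec : (k n a : ℕ) → Vector k
splitVec k n a = tabulate (λ i → f (toℕ i))
  where
  f : ℕ → ℕ
  f i with i <? a
  ... | yes _ = suc i
  ... | no _  = suc (n ∸ k + i)

IsSummingTableau : (k n : ℕ) → List (Vector k) → Tableau k n → Set
IsSummingTableau k n L T = ∀ (a : Fin k) (b : Fin (n ∸ k)) → T a b ≡ summingTableau k n L a b

module Submission where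

-- Everything rests on reading T through counts: with  count a x  the number
-- of I ∈ L with i_{a+1} ≤ x (positions are 0-based below),
--   * count a x < count a (x+1)  iff some I ∈ L has i_{a+1} = x+1, and
--   * count (a+1) (x+1) < count a x  iff some I ∈ L has i_{a+1} ≤ x < x+1 < i_{a+2}.
-- Row and column strictness of T say exactly that all such rises (drops)
-- occur, and the special vectors witness them, which gives the converse
-- implications.  For the forward implications noncrossingness assembles the
-- witnesses into one vector:
--   * shifts: a member agreeing with (s+1,…,s+k) below position m is replaced
--     by one agreeing below m+1, for any disagreement would produce crossing
--     arcs (downward induction over the positions below m);
--   * splits: induction over the columns yields a member with i_{a+1} = a+1 and
--     i_{a+2} beyond the last column; the bounds i+1 ≤ v_i ≤ n-k+i+1 of
--     increasing vectors then force it to be (1,…,a+1,n-k+a+2,…,n).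

open import Defs
open import Data.Nat using (ℕ; zero; suc; _+_; _∸_; _≤_; _<_; _≤?_; _<?_; _≟_; z≤n; s≤s; s≤s⁻¹)
open import Data.Nat.Properties
open import Data.Fin using (Fin; toℕ; fromℕ<)
import Data.Fin as F
open import Data.Fin.Properties using (toℕ-fromℕ<; toℕ<n)
open import Data.Vec using (Vec; []; _∷_; lookup; tabulate)
open import Data.Vec.Properties using (lookup∘tabulate; tabulate∘lookup; tabulate-cong)
open import Data.List using (List; []; _∷_; length; filter)
open import Data.List.Properties using (filter-≐)
open import Data.List.Relation.Unary.All using (All)
import Data.List.Relation.Unary.All as All
open import Data.List.Relation.Unary.AllPairs using (AllPairs; _∷_)
open import Data.List.Relation.Unary.Any using (here; there)
open import Data.List.Membership.Propositional using (_∈_)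
open import Data.Product using (Σ; _×_; _,_; proj₁; proj₂)
open import Data.Sum using (inj₁; inj₂)
open import Data.Empty using (⊥-elim)
open import Function.Base using (_∘_; _∋_)
open import Function.Bundles using (_⇔_; mk⇔; Equivalence)
open import Relation.Nullary using (¬_; yes; no)
open import Relation.Unary using (Decidable)
open import Relation.Binary.PropositionalEquality

open Equivalence using (to; from)

≤∸1⇒< : ∀ {x m} → 0 < m → x ≤ m ∸ 1 → x < m
≤∸1⇒< {m = suc m} _ x≤m = s≤s x≤m

<⇒≤∸1 : ∀ {x m} → x < m → x ≤ m ∸ 1
<⇒≤∸1 {m = suc m} (s≤s x≤m) = x≤m

-- The bound n at the last position k-1 has the shape (n-k+1) + (k-1) of upper-bound.
last-position : ∀ {k n} → 0 < k → k ≤ n → suc (n ∸ k) + (k ∸ 1) ≡ n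
last-position {suc k} _ k≤n = trans (sym (+-suc _ k)) (m∸n+n≡m k≤n)

module Counting {A : Set} {P Q : A → Set} (P? : Decidable P) (Q? : Decidable Q) where

  Included : List A → Set
  Included L = ∀ {x} → x ∈ L → P x → Q x

  private
    included-tail : ∀ {x L} → Included (x ∷ L) → Included L
    included-tail inc x∈L = inc (there x∈L)

  count-mono : ∀ L → Included L → length (filter P? L) ≤ length (filter Q? L)
  count-mono [] _ = z≤n
  count-mono (x ∷ L) inc with P? x | Q? x
  ... | yes _  | yes _  = s≤s (count-mono L (included-tail inc))
  ... | yes Px | no ¬Qx = ⊥-elim (¬Qx (inc (here refl) Px))
  ... | no _   | yes _  = m≤n⇒m≤1+n (count-mono L (included-tail inc))
  ... | no _   | no _   = count-mono L (included-tail inc)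

  count-<-witness : ∀ L → Included L → length (filter P? L) < length (filter Q? L) →
    Σ A λ x → x ∈ L × Q x × ¬ P x
  count-<-witness (x ∷ L) inc lt with P? x | Q? x
  ... | yes _  | yes _  =
    let (y , y∈L , Qy , ¬Py) = count-<-witness L (included-tail inc) (s≤s⁻¹ lt) in y , there y∈L , Qy , ¬Py
  ... | yes Px | no ¬Qx = ⊥-elim (¬Qx (inc (here refl) Px))
  ... | no ¬Px | yes Qx = x , here refl , Qx , ¬Px
  ... | no _   | no _   =
    let (y , y∈L , Qy , ¬Py) = count-<-witness L (included-tail inc) lt in y , there y∈L , Qy , ¬Py

  witness-count-< : ∀ L → Included L → ∀ {y} → y ∈ L → Q y → ¬ P y →
    length (filter P? L) < length (filter Q? L)
  witness-count-< (x ∷ L) inc (here refl) Qy ¬Py with P? x | Q? x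
  ... | yes Py | _      = ⊥-elim (¬Py Py)
  ... | no _   | yes _  = s≤s (count-mono L (included-tail inc))
  ... | no _   | no ¬Qy = ⊥-elim (¬Qy Qy)
  witness-count-< (x ∷ L) inc (there y∈L) Qy ¬Py with P? x | Q? x
  ... | yes _  | yes _  = s≤s (witness-count-< L (included-tail inc) y∈L Qy ¬Py)
  ... | yes Px | no ¬Qx = ⊥-elim (¬Qx (inc (here refl) Px))
  ... | no _   | yes _  = m≤n⇒m≤1+n (witness-count-< L (included-tail inc) y∈L Qy ¬Py)
  ... | no _   | no _   = witness-count-< L (included-tail inc) y∈L Qy ¬Py

-- Entries of a vector at natural-number positions (0 outside the range), so that
-- arguments over positions are ordinary inductions on ℕ.
at : ∀ {k} → Vec ℕ k → ℕ → ℕ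
at []      _       = 0
at (x ∷ _) zero    = x
at (_ ∷ v) (suc i) = at v i

at-lookup : ∀ {k} (v : Vec ℕ k) (i : Fin k) → at v (toℕ i) ≡ lookup v i
at-lookup (_ ∷ _) F.zero    = refl
at-lookup (_ ∷ v) (F.suc i) = at-lookup v i

at-fromℕ< : ∀ {k i} (v : Vec ℕ k) (i<k : i < k) → lookup v (fromℕ< i<k) ≡ at v i
at-fromℕ< v i<k = trans (sym (at-lookup v (fromℕ< i<k))) (cong (at v) (toℕ-fromℕ< i<k))

at-tabulate : ∀ {k i} (f : Fin k → ℕ) (i<k : i < k) → at (tabulate f) i ≡ f (fromℕ< i<k)
at-tabulate f i<k = trans (sym (at-fromℕ< (tabulate f) i<k)) (lookup∘tabulate f (fromℕ< i<k))

vec-ext : ∀ {k} (v w : Vec ℕ k) → (∀ i → i < k → at v i ≡ at w i) → v ≡ w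
vec-ext v w same = begin
  v                ≡⟨ tabulate∘lookup v ⟨
  tabulate (lookup v) ≡⟨ tabulate-cong (λ i →
                           trans (sym (at-lookup v i)) (trans (same (toℕ i) (toℕ<n i)) (at-lookup w i))) ⟩
  tabulate (lookup w) ≡⟨ tabulate∘lookup w ⟩
  w                ∎
  where open ≡-Reasoning

-- The entries of the special vectors of the theorem.  For splitVec, ascribing
-- at-tabulate to the entry exposes the case split defining splitVec, which the
-- accompanying `with` then resolves.

at-shiftVec : ∀ {k s i} → i < k → at (shiftVec k s) i ≡ suc (s + i)
at-shiftVec {k} {s} i<k = trans (at-tabulate _ i<k) (cong (suc ∘ (s +_)) (toℕ-fromℕ< i<k))

at-splitVec-low : ∀ {k n a i} → i < k → i < a → at (splitVec k n a) i ≡ suc i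
at-splitVec-low {k} {n} {a} {i} i<k i<a
  with toℕ (fromℕ< i<k) <? a | (at (splitVec k n a) i ≡ _ ∋ at-tabulate _ i<k)
... | yes _ | entry = trans entry (cong suc (toℕ-fromℕ< i<k))
... | no ≮a | _     = ⊥-elim (≮a (subst (_< a) (sym (toℕ-fromℕ< i<k)) i<a))

at-splitVec-high : ∀ {k n a i} → i < k → a ≤ i → at (splitVec k n a) i ≡ suc (n ∸ k + i)
at-splitVec-high {k} {n} {a} {i} i<k a≤i
  with toℕ (fromℕ< i<k) <? a | (at (splitVec k n a) i ≡ _ ∋ at-tabulate _ i<k)
... | yes <a | _     = ⊥-elim (<⇒≱ (subst (_< a) (toℕ-fromℕ< i<k) <a) a≤i)
... | no _   | entry = trans entry (cong (suc ∘ (n ∸ k +_)) (toℕ-fromℕ< i<k))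

module Increasing {k n : ℕ} (v : Vector k) (v∈V : InV k n v) where

  in-range : ∀ {i} → i < k → 1 ≤ at v i × at v i ≤ n
  in-range i<k = subst (λ x → 1 ≤ x × x ≤ n) (at-fromℕ< v i<k) (proj₁ v∈V (fromℕ< i<k))

  increases : ∀ {i j} → i < j → j < k → at v i < at v j
  increases {i} {j} i<j j<k =
    subst₂ _<_ (at-fromℕ< v i<k) (at-fromℕ< v j<k) (proj₂ v∈V (fromℕ< i<k) (fromℕ< j<k) positions<)
    where
    i<k = <-trans i<j j<k
    positions< : fromℕ< i<k F.< fromℕ< j<k
    positions< = subst₂ _<_ (sym (toℕ-fromℕ< i<k)) (sym (toℕ-fromℕ< j<k)) i<j

  gap : ∀ c d → c + d < k → at v c + d ≤ at v (c + d)
  gap c zero p = ≤-reflexive (trans (+-identityʳ _) (cong (at v) (sym (+-identityʳ c))))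
  gap c (suc d) p = begin
    at v c + suc d     ≡⟨ +-suc _ d ⟩
    suc (at v c + d)   ≤⟨ s≤s (gap c d (<-trans (n<1+n (c + d)) next<k)) ⟩
    suc (at v (c + d)) ≤⟨ increases (n<1+n (c + d)) next<k ⟩
    at v (suc (c + d)) ≡⟨ cong (at v) (+-suc c d) ⟨
    at v (c + suc d)   ∎
    where
    open ≤-Reasoning
    next<k : suc (c + d) < k
    next<k = subst (_< k) (+-suc c d) p

  capped-below : ∀ X {c m} → c ≤ m → m < k → at v m ≤ X + m → at v c ≤ X + c
  capped-below X {c} {m} c≤m m<k cap = +-cancelʳ-≤ (m ∸ c) _ _ (begin
    at v c + (m ∸ c)   ≤⟨ gap c (m ∸ c) (subst (_< k) (sym split) m<k) ⟩
    at v (c + (m ∸ c)) ≡⟨ cong (at v) split ⟩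
    at v m             ≤⟨ cap ⟩
    X + m              ≡⟨ cong (X +_) split ⟨
    X + (c + (m ∸ c))  ≡⟨ +-assoc X c _ ⟨
    X + c + (m ∸ c)    ∎)
    where
    open ≤-Reasoning
    split = m+[n∸m]≡n c≤m

  floored-above : ∀ X {c m} → c ≤ m → m < k → X + c ≤ at v c → X + m ≤ at v m
  floored-above X {c} {m} c≤m m<k floor = begin
    X + m              ≡⟨ cong (X +_) split ⟨
    X + (c + (m ∸ c))  ≡⟨ +-assoc X c _ ⟨
    X + c + (m ∸ c)    ≤⟨ +-monoˡ-≤ (m ∸ c) floor ⟩
    at v c + (m ∸ c)   ≤⟨ gap c (m ∸ c) (subst (_< k) (sym split) m<k) ⟩
    at v (c + (m ∸ c)) ≡⟨ cong (at v) split ⟩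
    at v m             ∎
    where
    open ≤-Reasoning
    split = m+[n∸m]≡n c≤m

  lower-bound : ∀ {i} → i < k → suc i ≤ at v i
  lower-bound i<k = floored-above 1 z≤n i<k (proj₁ (in-range (≤-<-trans z≤n i<k)))

  upper-bound : k ≤ n → ∀ {i} → i < k → at v i ≤ suc (n ∸ k) + i
  upper-bound k≤n i<k = capped-below (suc (n ∸ k)) (<⇒≤∸1 i<k) last<k
    (subst (at v (k ∸ 1) ≤_) (sym (last-position 0<k k≤n)) (proj₂ (in-range last<k)))
    where
    0<k = ≤-<-trans z≤n i<k
    last<k = ≤∸1⇒< 0<k ≤-refl

cross-cong : ∀ {p p' q q' r r' s s'} → p ≡ r → p' ≡ r' → q ≡ s → q' ≡ s' →
  Cross p p' q q' → Cross r r' s s'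
cross-cong refl refl refl refl crossing = crossing

noncrossing-at : ∀ {k I J} → Noncrossing k I J → ∀ {a b} → a < b → b < k →
  (∀ l → a < l → l < b → at I l ≡ at J l) → ¬ Cross (at I a) (at I b) (at J a) (at J b)
noncrossing-at {k} {I} {J} nc {a} {b} a<b b<k same-between crossing =
  nc (fromℕ< a<k) (fromℕ< b<k) positions< same-between'
    (cross-cong (sym (at-fromℕ< I a<k)) (sym (at-fromℕ< I b<k))
                (sym (at-fromℕ< J a<k)) (sym (at-fromℕ< J b<k)) crossing)
  where
  a<k = <-trans a<b b<k
  positions< : fromℕ< a<k F.< fromℕ< b<k
  positions< = subst₂ _<_ (sym (toℕ-fromℕ< a<k)) (sym (toℕ-fromℕ< b<k)) a<b
  same-between' : ∀ l → fromℕ< a<k F.< l → l F.< fromℕ< b<k → lookup I l ≡ lookup J l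
  same-between' l a<l l<b = begin
    lookup I l   ≡⟨ at-lookup I l ⟨
    at I (toℕ l) ≡⟨ same-between (toℕ l) (subst (_< toℕ l) (toℕ-fromℕ< a<k) a<l)
                                         (subst (toℕ l <_) (toℕ-fromℕ< b<k) l<b) ⟩
    at J (toℕ l) ≡⟨ at-lookup J l ⟩
    lookup J l   ∎
    where open ≡-Reasoning

self-noncrossing : ∀ {k} (I : Vector k) → Noncrossing k I I
self-noncrossing I _ _ _ _ (inj₁ (p<p , _)) = <-irrefl refl p<p
self-noncrossing I _ _ _ _ (inj₂ (p<p , _)) = <-irrefl refl p<p

noncrossing-sym : ∀ {k I J} → Noncrossing k I J → Noncrossing k J I
noncrossing-sym nc a b a<b same-between (inj₁ crossing) = nc a b a<b (λ l p q → sym (same-between l p q)) (inj₂ crossing)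
noncrossing-sym nc a b a<b same-between (inj₂ crossing) = nc a b a<b (λ l p q → sym (same-between l p q)) (inj₁ crossing)

member-noncrossing : ∀ {k L I J} → AllPairs (Noncrossing k) L → I ∈ L → J ∈ L → Noncrossing k I J
member-noncrossing {I = I} (_ ∷ _) (here refl) (here refl) = self-noncrossing I
member-noncrossing (I∼ ∷ _) (here refl) (there J∈L) = All.lookup I∼ J∈L
member-noncrossing {I = I} {J} (J∼ ∷ _) (there I∈L) (here refl) = noncrossing-sym {I = J} {I} (All.lookup J∼ I∈L)
member-noncrossing (_ ∷ pairwise) (there I∈L) (there J∈L) = member-noncrossing pairwise I∈L J∈L

downward-induction : ∀ (P : ℕ → Set) {m} → (∀ c → c < m → (∀ l → c < l → l < m → P l) → P c) →
  ∀ c → c < m → P c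
downward-induction P {m} step c c<m = go m c (m≤n⇒m≤1+n (m≤n+m m c)) c<m
  where
  go : ∀ d c → m ≤ suc (c + d) → c < m → P c
  go zero c m≤c+1 c<m = step c c<m (λ l c<l l<m →
    ⊥-elim (<⇒≱ l<m (≤-trans m≤c+1 (subst (_≤ l) (cong suc (sym (+-identityʳ c))) c<l))))
  go (suc d) c m≤ c<m = step c c<m (λ l c<l l<m → go d l (≤-trans m≤ (s≤s (shifted l c<l))) l<m)
    where
    shifted : ∀ l → c < l → c + suc d ≤ l + d
    shifted l c<l = subst (_≤ l + d) (sym (+-suc c d)) (+-monoˡ-≤ d c<l)

-- The number of members of L whose entry at position a is at most x; the
-- summing tableau has  t_{a+1,b+1} = count L a (a+b+1).
count : ∀ {k} → List (Vector k) → ℕ → ℕ → ℕ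
count L a x = length (filter (λ v → at v a ≤? x) L)

count-rise⇔ : ∀ {k} (L : List (Vector k)) a x →
  count L a x < count L a (suc x) ⇔ Σ (Vector k) λ v → v ∈ L × at v a ≡ suc x
count-rise⇔ {k} L a x = mk⇔
  (λ rise → let (v , v∈L , ≤x+1 , ≰x) = count-<-witness L (λ _ → m≤n⇒m≤1+n) rise
            in v , v∈L , ≤-antisym ≤x+1 (≰⇒> ≰x))
  (λ (v , v∈L , hit) → witness-count-< L (λ _ → m≤n⇒m≤1+n) v∈L (≤-reflexive hit)
                         (λ ≤x → 1+n≰n (subst (_≤ x) hit ≤x)))
  where open Counting (λ (v : Vector k) → at v a ≤? x) (λ v → at v a ≤? suc x)

module Family {k n : ℕ} (L : List (Vector k)) (increasing : ∀ {v} → v ∈ L → InV k n v) where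

  private
    module Member {v} (v∈L : v ∈ L) = Increasing v (increasing v∈L)

  count-drop⇔ : ∀ {a} → suc a < k → ∀ x →
    count L (suc a) (suc x) < count L a x ⇔ Σ (Vector k) λ v → v ∈ L × at v a ≤ x × suc x < at v (suc a)
  count-drop⇔ {a} a+1<k x = mk⇔
    (λ drop → let (v , v∈L , ≤x , ≰x+1) = count-<-witness L included drop in v , v∈L , ≤x , ≰⇒> ≰x+1)
    (λ (v , v∈L , ≤x , x+1<) → witness-count-< L included v∈L ≤x (<⇒≱ x+1<))
    where
    open Counting (λ v → at v (suc a) ≤? suc x) (λ v → at v a ≤? x)
    included : Included L
    included v∈L next≤ = s≤s⁻¹ (≤-trans (Member.increases v∈L (n<1+n a) a+1<k) next≤)

  module Assembly (pairwise : AllPairs (Noncrossing k) L) where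

    no-crossing : ∀ {I J} → I ∈ L → J ∈ L → ∀ {a b} → a < b → b < k →
      (∀ l → a < l → l < b → at I l ≡ at J l) → ¬ Cross (at I a) (at I b) (at J a) (at J b)
    no-crossing {I} {J} I∈L J∈L = noncrossing-at {I = I} {J} (member-noncrossing pairwise I∈L J∈L)

    AgreesBelow : ℕ → Vector k → ℕ → Set
    AgreesBelow s v m = ∀ c → c < m → at v c ≡ suc (s + c)

    agree-snoc : ∀ {s v m} → AgreesBelow s v m → at v m ≡ suc (s + m) → AgreesBelow s v (suc m)
    agree-snoc {m = m} agrees hit c c<m+1 with m≤n⇒m<n∨m≡n (s≤s⁻¹ c<m+1)
    ... | inj₁ c<m  = agrees c c<m
    ... | inj₂ refl = hit

    agreeing-above : ∀ {s m v} → v ∈ L → 0 < m → m < k → AgreesBelow s v m → suc (s + m) ≤ at v m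
    agreeing-above {s} {suc m} {v} v∈L _ m+1<k agrees =
      subst (_≤ at v (suc m)) (cong suc (sym (+-suc s m)))
        (subst (λ x → suc x ≤ at v (suc m)) (agrees m (n<1+n m)) (Member.increases v∈L (n<1+n m) m+1<k))

    -- If I agrees below m but not at m, a member J hitting the value at m agrees
    -- below m+1: at a last disagreement c < m we would have
    -- j_c < i_c < j_m < i_m with equal entries in between, a crossing.
    extend-agreement : ∀ {s m I J} → I ∈ L → J ∈ L → m < k → AgreesBelow s I m →
      at I m ≢ suc (s + m) → at J m ≡ suc (s + m) → AgreesBelow s J (suc m)
    extend-agreement {s} {m} {I} {J} I∈L J∈L m<k I-agrees I-misses J-hits =
      agree-snoc {v = J} (downward-induction (λ c → at J c ≡ suc (s + c)) step) J-hits
      where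
      step : ∀ c → c < m → (∀ l → c < l → l < m → at J l ≡ suc (s + l)) → at J c ≡ suc (s + c)
      step c c<m J-agrees-between with at J c ≟ suc (s + c)
      ... | yes hit  = hit
      ... | no  miss = ⊥-elim (no-crossing I∈L J∈L c<m m<k same-between (inj₂ (J<I , I<J , J<I')))
        where
        same-between : ∀ l → c < l → l < m → at I l ≡ at J l
        same-between l c<l l<m = trans (I-agrees l l<m) (sym (J-agrees-between l c<l l<m))
        J<I : at J c < at I c
        J<I = subst (at J c <_) (sym (I-agrees c c<m))
          (≤∧≢⇒< (Member.capped-below J∈L (suc s) (<⇒≤ c<m) m<k (≤-reflexive J-hits)) miss)
        I<J : at I c < at J m
        I<J = subst₂ _<_ (sym (I-agrees c c<m)) (sym J-hits) (s≤s (+-monoʳ-< s c<m))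
        J<I' : at J m < at I m
        J<I' = ≤∧≢⇒< (subst (_≤ at I m) (sym J-hits) (agreeing-above I∈L (≤-<-trans z≤n c<m) m<k I-agrees))
                     (λ same → I-misses (trans (sym same) J-hits))

    Attained : ℕ → Set
    Attained s = ∀ {a} → a < k → Σ (Vector k) λ v → v ∈ L × at v a ≡ suc (s + a)

    agreeing-prefix : ∀ {s} → 0 < k → Attained s → ∀ m → m ≤ k → Σ (Vector k) λ v → v ∈ L × AgreesBelow s v m
    agreeing-prefix 0<k attained zero _ = let (v , v∈L , _) = attained 0<k in v , v∈L , λ _ ()
    agreeing-prefix {s} 0<k attained (suc m) m<k with agreeing-prefix 0<k attained m (<⇒≤ m<k)
    ... | I , I∈L , I-agrees with at I m ≟ suc (s + m)
    ...   | yes hit  = I , I∈L , agree-snoc {v = I} I-agrees hit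
    ...   | no  miss = let (J , J∈L , J-hits) = attained m<k
                       in J , J∈L , extend-agreement I∈L J∈L m<k I-agrees miss J-hits

    shift-member : ∀ {s} → 0 < k → Attained s → shiftVec k s ∈ L
    shift-member {s} 0<k attained =
      let (v , v∈L , agrees) = agreeing-prefix 0<k attained k ≤-refl
      in subst (_∈ L) (vec-ext v _ (λ i i<k → trans (agrees i i<k) (sym (at-shiftVec i<k)))) v∈L

    Straddles : ℕ → ℕ → Vector k → Set
    Straddles a b v = at v a ≤ suc (a + b) × suc (suc (a + b)) < at v (suc a)

    -- If positions a, a+1 straddle every column, then for each column b some
    -- member has v_a = a+1 and v_{a+1} > a+b+2.  Induction on b: a member I for b
    -- either works for b+1, or i_{a+1} = a+b+3 and the straddling member J for
    -- b+1 has j_a = a+1, since otherwise i_a < j_a < i_{a+1} < j_{a+1}.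
    lowest-straddle : ∀ {a} → suc a < k → (∀ {b} → b < n ∸ k → Σ (Vector k) λ v → v ∈ L × Straddles a b v) →
      ∀ b → b < n ∸ k → Σ (Vector k) λ v → v ∈ L × at v a ≡ suc a × suc (suc (a + b)) < at v (suc a)
    lowest-straddle {a} a+1<k straddle zero 0<w with straddle 0<w
    ... | v , v∈L , v-low , v-high =
      v , v∈L , ≤-antisym (subst (at v a ≤_) (cong suc (+-identityʳ a)) v-low)
                          (Member.lower-bound v∈L (<-trans (n<1+n a) a+1<k)) , v-high
    lowest-straddle {a} a+1<k straddle (suc b) b+1<w
      with lowest-straddle a+1<k straddle b (<-trans (n<1+n b) b+1<w)
    ... | I , I∈L , I-low , I-high with suc (suc (a + suc b)) <? at I (suc a)
    ...   | yes I-higher = I , I∈L , I-low , I-higher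
    ...   | no  I-near with straddle b+1<w
    ...     | J , J∈L , J-low , J-high with at J a ≟ suc a
    ...       | yes J-lowest = J , J∈L , J-lowest , J-high
    ...       | no  J-higher = ⊥-elim (no-crossing I∈L J∈L (n<1+n a) a+1<k nothing-between
                                 (inj₁ (I<J , J<I' , I'<J')))
      where
      nothing-between : ∀ l → a < l → l < suc a → at I l ≡ at J l
      nothing-between l a<l l<a+1 = ⊥-elim (<⇒≱ l<a+1 a<l)
      I<J : at I a < at J a
      I<J = subst (_< at J a) (sym I-low)
        (≤∧≢⇒< (Member.lower-bound J∈L (<-trans (n<1+n a) a+1<k)) (J-higher ∘ sym))
      J<I' : at J a < at I (suc a)
      J<I' = ≤-<-trans J-low (subst (λ x → suc x < at I (suc a)) (sym (+-suc a b)) I-high)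
      I'<J' : at I (suc a) < at J (suc a)
      I'<J' = ≤-<-trans (≮⇒≥ I-near) J-high

    split-member : ∀ {a} → k < n → suc a < k →
      (∀ {b} → b < n ∸ k → Σ (Vector k) λ v → v ∈ L × Straddles a b v) → splitVec k n (suc a) ∈ L
    split-member {a} k<n a+1<k straddle = subst (_∈ L) (vec-ext v _ entries) v∈L
      where
      0<w = m<n⇒0<n∸m k<n
      lowest = lowest-straddle a+1<k straddle (n ∸ k ∸ 1) (≤∸1⇒< 0<w ≤-refl)
      v = proj₁ lowest
      v∈L = proj₁ (proj₂ lowest)
      v-low : at v a ≡ suc a
      v-low = proj₁ (proj₂ (proj₂ lowest))
      v-high : suc (n ∸ k) + suc a ≤ at v (suc a)
      v-high = subst (_≤ at v (suc a)) (sym (last-column (n ∸ k) 0<w)) (proj₂ (proj₂ (proj₂ lowest)))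
        where
        last-column : ∀ w → 0 < w → suc w + suc a ≡ suc (suc (suc (a + (w ∸ 1))))
        last-column (suc r) _ = cong (suc ∘ suc) (trans (+-suc r a) (cong suc (+-comm r a)))
      entries : ∀ i → i < k → at v i ≡ at (splitVec k n (suc a)) i
      entries i i<k with i <? suc a
      ... | yes i<a+1 = trans (≤-antisym (Member.capped-below v∈L 1 (s≤s⁻¹ i<a+1) (<-trans (n<1+n a) a+1<k)
                                                              (≤-reflexive v-low))
                                         (Member.lower-bound v∈L i<k))
                              (sym (at-splitVec-low i<k i<a+1))
      ... | no  i≮a+1 = trans (≤-antisym (Member.upper-bound v∈L (<⇒≤ k<n) i<k)
                                         (Member.floored-above v∈L (suc (n ∸ k)) (≮⇒≥ i≮a+1) i<k v-high))
                              (sym (at-splitVec-high i<k (≮⇒≥ i≮a+1)))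

module Reading {k n : ℕ} (T : Tableau k n) (L : List (Vector k)) (summing : IsSummingTableau k n L T) where

  entry : ∀ a b → T a b ≡ count L (toℕ a) (suc (toℕ a + toℕ b))
  entry a b = trans (summing a b) (cong length (filter-≐ _ _ ((λ {v} → to-at {v}) , (λ {v} → from-at {v})) L))
    where
    to-at : ∀ {v} → lookup v a ≤ suc (toℕ a + toℕ b) → at v (toℕ a) ≤ suc (toℕ a + toℕ b)
    to-at {v} = subst (_≤ _) (sym (at-lookup v a))
    from-at : ∀ {v} → at v (toℕ a) ≤ suc (toℕ a + toℕ b) → lookup v a ≤ suc (toℕ a + toℕ b)
    from-at {v} = subst (_≤ _) (at-lookup v a)

  entryℕ : ∀ {a b} (a<k : a < k) (b<w : b < n ∸ k) → T (fromℕ< a<k) (fromℕ< b<w) ≡ count L a (suc (a + b))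
  entryℕ a<k b<w = trans (entry _ _) (cong₂ (λ a b → count L a (suc (a + b))) (toℕ-fromℕ< a<k) (toℕ-fromℕ< b<w))

  Rises : Set
  Rises = ∀ {a b} → a < k → suc b < n ∸ k → count L a (suc (a + b)) < count L a (suc (suc (a + b)))

  rowStrict⇔rises : RowStrict k n T ⇔ Rises
  rowStrict⇔rises = mk⇔ rises strictness
    where
    rises : RowStrict k n T → Rises
    rises row-strict {a} {b} a<k b+1<w =
      subst₂ _<_ (entryℕ a<k b<w) (trans (entryℕ a<k b+1<w) (cong (count L a ∘ suc) (+-suc a b)))
        (row-strict (fromℕ< a<k) (fromℕ< b<w) (fromℕ< b+1<w)
          (trans (toℕ-fromℕ< b+1<w) (cong suc (sym (toℕ-fromℕ< b<w)))))
      where b<w = <-trans (n<1+n b) b+1<w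
    strictness : Rises → RowStrict k n T
    strictness rise a b b' b'≡b+1 =
      subst₂ _<_ (sym (entry a b)) (sym next-entry) (rise (toℕ<n a) (subst (_< n ∸ k) b'≡b+1 (toℕ<n b')))
      where
      next-entry : T a b' ≡ count L (toℕ a) (suc (suc (toℕ a + toℕ b)))
      next-entry = trans (entry a b') (cong (λ c → count L (toℕ a) (suc c))
                                            (trans (cong (toℕ a +_) b'≡b+1) (+-suc (toℕ a) (toℕ b))))

  Drops : Set
  Drops = ∀ {a b} → suc a < k → b < n ∸ k → count L (suc a) (suc (suc (a + b))) < count L a (suc (a + b))

  colStrict⇔drops : ColStrict k n T ⇔ Drops
  colStrict⇔drops = mk⇔ drops strictness
    where
    drops : ColStrict k n T → Drops
    drops col-strict {a} {b} a+1<k b<w =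
      subst₂ _<_ (entryℕ a+1<k b<w) (entryℕ a<k b<w)
        (col-strict (fromℕ< a<k) (fromℕ< a+1<k) (fromℕ< b<w)
          (trans (toℕ-fromℕ< a+1<k) (cong suc (sym (toℕ-fromℕ< a<k)))))
      where a<k = <-trans (n<1+n a) a+1<k
    strictness : Drops → ColStrict k n T
    strictness drop a a' b a'≡a+1 =
      subst₂ _<_ (sym (trans (entry a' b) (cong (λ c → count L c (suc (c + toℕ b))) a'≡a+1))) (sym (entry a b))
        (drop (subst (_< k) a'≡a+1 (toℕ<n a')) (toℕ<n b))

module Main {k n : ℕ} (0<k : 0 < k) (k<n : k < n) (T : Tableau k n) (L : List (Vector k))
            (all-V* : All (InVstar k n) L) (pairwise : AllPairs (Noncrossing k) L)
            (summing : IsSummingTableau k n L T) where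

  open Family L (λ v∈L → proj₁ (All.lookup all-V* v∈L))
  open Assembly pairwise
  open Reading T L summing

  0<w : 0 < n ∸ k
  0<w = m<n⇒0<n∸m k<n

  rows-strict⇔shifts : RowStrict k n T ⇔ (∀ b → 1 ≤ b → b ≤ n ∸ k ∸ 1 → shiftVec k b ∈ L)
  rows-strict⇔shifts = mk⇔ (shifts ∘ to rowStrict⇔rises) (from rowStrict⇔rises ∘ rises)
    where
    shifts : Rises → ∀ b → 1 ≤ b → b ≤ n ∸ k ∸ 1 → shiftVec k b ∈ L
    shifts rise (suc b) _ b+1≤ = shift-member 0<k λ {a} a<k →
      let (v , v∈L , hit) = to (count-rise⇔ L a _) (rise a<k (≤∸1⇒< 0<w b+1≤))
      in v , v∈L , trans hit (cong (suc ∘ suc) (+-comm a b))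
    rises : (∀ b → 1 ≤ b → b ≤ n ∸ k ∸ 1 → shiftVec k b ∈ L) → Rises
    rises shifts {a} {b} a<k b+1<w = from (count-rise⇔ L a _)
      (shiftVec k (suc b) , shifts (suc b) (s≤s z≤n) (<⇒≤∸1 b+1<w) ,
       trans (at-shiftVec a<k) (cong (suc ∘ suc) (+-comm b a)))

  columns-strict⇔splits : ColStrict k n T ⇔ (∀ a → 1 ≤ a → a ≤ k ∸ 1 → splitVec k n a ∈ L)
  columns-strict⇔splits = mk⇔ (splits ∘ to colStrict⇔drops) (from colStrict⇔drops ∘ drops)
    where
    splits : Drops → ∀ a → 1 ≤ a → a ≤ k ∸ 1 → splitVec k n a ∈ L
    splits drop (suc a) _ a+1≤ =
      split-member k<n a+1<k (λ b<w → to (count-drop⇔ a+1<k _) (drop a+1<k b<w))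
      where a+1<k = ≤∸1⇒< 0<k a+1≤
    drops : (∀ a → 1 ≤ a → a ≤ k ∸ 1 → splitVec k n a ∈ L) → Drops
    drops splits {a} {b} a+1<k b<w = from (count-drop⇔ a+1<k _)
      (splitVec k n (suc a) , splits (suc a) (s≤s z≤n) (<⇒≤∸1 a+1<k) ,
       subst (_≤ suc (a + b)) (sym (at-splitVec-low (<-trans (n<1+n a) a+1<k) (n<1+n a))) (s≤s (m≤m+n a b)) ,
       subst (suc (suc (a + b)) <_) (sym (at-splitVec-high a+1<k ≤-refl))
         (s≤s (subst (suc (suc (a + b)) ≤_) (sym (+-suc (n ∸ k) a))
           (s≤s (subst (λ x → suc x ≤ n ∸ k + a) (+-comm b a) (+-monoˡ-≤ a b<w))))))

lemma2p9 : (k n : ℕ) → 1 ≤ k → k < n →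
    (T : Tableau k n) → InTkn k n T →
    (L : List (Vector k)) → All (InVstar k n) L → AllPairs (Noncrossing k) L →
    IsSummingTableau k n L T →
    (RowStrict k n T ⇔ (∀ (b : ℕ) → 1 ≤ b → b ≤ n ∸ k ∸ 1 → shiftVec k b ∈ L)) ×
    (ColStrict k n T ⇔ (∀ (a : ℕ) → 1 ≤ a → a ≤ k ∸ 1 → splitVec k n a ∈ L))
lemma2p9 k n 1≤k k<n T _ L all-V* pairwise summing = rows-strict⇔shifts , columns-strict⇔splits
  where open Main 1≤k k<n T L all-V* pairwise summing
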